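{- For every $A\in\mathrm{Avoid}(m,F(1,2,2,1))$ with more than $m+1$ columns, the underlying undirected graph of any procedure graph of $A$ is simple; i.e., no two edges of the procedure graph join the same pair of vertices (in either direction).
   Context: A $(0,1)$-matrix is simple if it has no repeated columns; $\|A\|$ is its number of columns. $\mathrm{Avoid}(m,F)$ is the set of $m$-rowed simple matrices not containing $F$ as a configuration (a row and column permutation of a submatrix). $F(1,2,2,1)$ is the $2\times 6$ matrix with one column $(0,0)^T$, two columns $(1,0)^T$, two columns $(0,1)^T$, one column $(1,1)^T$. Procedure graph: let $A\in\mathrm{Avoid}(m,F(1,2,2,1))$ with $n>m+1$ columns. Set $A_0=A$, $E_0=\emptyset$. For $i\ge0$, while $\|A_i\|>m+1$: $A_i$ is simple with more than $m+1$ columns, so there are two rows $j,k$ on which $A_i$ contains all four columns $(0,0)^T,(0,1)^T,(1,0)^T,(1,1)^T$; since $A_i$ avoids $F(1,2,2,1)$, one of the patterns ($0$ in row $j$, $1$ in row $k$) or ($1$ in row $j$, $0$ in row $k$) occurs in exactly one column $\alpha$ of $A_i$. Choose such $j,k$ and such a pattern, let $A_{i+1}$ be $A_i$ with $\alpha$ deleted, and let $E_{i+1}=E_i\cup\{(x,y)\}$, where $x\in\{j,k\}$ is the row with entry $0$ in $\alpha$ and $y$ the row with entry $1$. The procedure stops after $n-m-1$ steps; the directed graph on vertex set $[m]$ (the rows) with edge set $E=E_{n-m-1}$ is a procedure graph of $A$ (choices are arbitrary, so there may be several). -}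

module Defs where

open import Data.Nat using (ℕ; zero; suc; _+_; _<_)
open import Data.Fin using (Fin; zero; suc; punchIn)
open import Data.Bool using (Bool; true; false; not)
open import Data.Product using (_×_; _,_; Σ; ∃; ∃-syntax)
open import Data.Sum using (_⊎_)
open import Data.List using (List; []; _∷_; length; lookup)
open import Relation.Binary.PropositionalEquality using (_≡_; _≢_)
open import Relation.Nullary using (¬_)

-- A (0,1)-matrix with m rows and n columns, given column-wise:
-- A c r is the entry in column c, row r (false = 0, true = 1).
Matrix : ℕ → ℕ → Set
Matrix m n = Fin n → Fin m → Bool

Simple : ∀ {m n} → Matrix m n → Set
Simple {m} {n} A = ∀ (c d : Fin n) → (∀ (r : Fin m) → A c r ≡ A d r) → c ≡ d

-- A contains F as a configuration: some row and column permutation of a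
-- submatrix of A equals F, i.e. injective row and column selections.
Contains : ∀ {m n k l} → Matrix m n → Matrix k l → Set
Contains {m} {n} {k} {l} A F =
  Σ (Fin k → Fin m) λ ρ → Σ (Fin l → Fin n) λ γ →
    ((∀ (r s : Fin k) → ρ r ≡ ρ s → r ≡ s) ×
     (∀ (c d : Fin l) → γ c ≡ γ d → c ≡ d) ×
     (∀ (c : Fin l) (r : Fin k) → A (γ c) (ρ r) ≡ F c r))

-- F(1,2,2,1): columns (0,0), (1,0), (1,0), (0,1), (0,1), (1,1).
F1221 : Matrix 2 6
F1221 zero                                zero       = false
F1221 zero                                (suc zero) = false
F1221 (suc zero)                          zero       = true
F1221 (suc zero)                          (suc zero) = false
F1221 (suc (suc zero))                    zero       = true
F1221 (suc (suc zero))                    (suc zero) = false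
F1221 (suc (suc (suc zero)))              zero       = false
F1221 (suc (suc (suc zero)))              (suc zero) = true
F1221 (suc (suc (suc (suc zero))))        zero       = false
F1221 (suc (suc (suc (suc zero))))        (suc zero) = true
F1221 (suc (suc (suc (suc (suc zero))))) zero       = true
F1221 (suc (suc (suc (suc (suc zero))))) (suc zero) = true

InAvoid : ∀ {m n} → Matrix m n → Set
InAvoid A = Simple A × ¬ Contains A F1221

deleteCol : ∀ {m n} → Matrix m (suc n) → Fin (suc n) → Matrix m n
deleteCol A α = λ c → A (punchIn α c)

Edge : ℕ → Set
Edge m = Fin m × Fin m

-- The edge recorded when deleting column α for rows j, k:
-- x is the row with entry 0 in α, y the row with entry 1.
edgeOf : ∀ {m} → Bool → Fin m → Fin m → Edge m
edgeOf false j k = (j , k)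
edgeOf true  j k = (k , j)

-- ProcRun A E: running the procedure from A (while the number of columns
-- exceeds m+1) can produce the list E of edges, in order of deletion.
data ProcRun {m : ℕ} : ∀ {n} → Matrix m n → List (Edge m) → Set where
  stop : ∀ {n} {A : Matrix m n} → ¬ (suc m < n) → ProcRun A []
  step : ∀ {n} {A : Matrix m (suc n)} {E : List (Edge m)}
           (j k : Fin m) (a : Bool) (α : Fin (suc n)) →
           suc m < suc n →
           j ≢ k →
           (∀ (u v : Bool) → ∃[ β ] (A β j ≡ u × A β k ≡ v)) →
           A α j ≡ a → A α k ≡ not a →
           (∀ (β : Fin (suc n)) → A β j ≡ a → A β k ≡ not a → β ≡ α) →
           ProcRun (deleteCol A α) E →
           ProcRun A (edgeOf a j k ∷ E)

SamePair : ∀ {m} → Edge m → Edge m → Set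
SamePair (x , y) (x' , y') = (x ≡ x' × y ≡ y') ⊎ (x ≡ y' × y ≡ x')

UndirectedSimple : ∀ {m} → List (Edge m) → Set
UndirectedSimple E =
  ∀ (p q : Fin (length E)) → p ≢ q → ¬ SamePair (lookup E p) (lookup E q)

{-# OPTIONS --safe #-}
-- Let the edge (x , y) be recorded when the unique column with 0 in row x and
-- 1 in row y is deleted. Afterwards no column has that pattern on x, y, and
-- deleting further columns cannot create one. A later step on the rows {x, y},
-- in either order, would need all four patterns on them, this one included;
-- so the pair x, y is never joined again.
module Submission where

open import Defs
open import Data.Nat using (ℕ; suc; _<_)
open import Data.Bool using (Bool; true; false; not)
open import Data.Empty using (⊥; ⊥-elim)
open import Data.Fin using (Fin; zero; suc; punchIn)
open import Data.Fin.Properties using (punchInᵢ≢i)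
open import Data.List using (List; _∷_)
open import Data.List.Relation.Unary.All as All using (All; []; _∷_)
open import Data.List.Membership.Propositional.Properties using (∈-lookup)
open import Data.Product using (_×_; _,_; ∃-syntax; swap; map₂)
open import Data.Sum using (inj₁; inj₂)
open import Function using (id; _∘_)
open import Relation.Binary.PropositionalEquality using (_≡_; refl; cong)
open import Relation.Nullary using (¬_)

private
  variable
    m n : ℕ
    e f : Edge m
    E : List (Edge m)

AllFour : Matrix m n → Edge m → Set
AllFour B (x , y) = ∀ (u v : Bool) → ∃[ β ] (B β x ≡ u × B β y ≡ v)

Lacks01 : Matrix m n → Edge m → Set
Lacks01 {n = n} B (x , y) = ∀ (β : Fin n) → B β x ≡ false → B β y ≡ true → ⊥

SamePair-sym : SamePair e f → SamePair f e
SamePair-sym {e = _ , _} {f = _ , _} (inj₁ (refl , refl)) = inj₁ (refl , refl)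
SamePair-sym {e = _ , _} {f = _ , _} (inj₂ (refl , refl)) = inj₂ (refl , refl)

AllFour-swap : (B : Matrix m n) (e : Edge m) → AllFour B e → AllFour B (swap e)
AllFour-swap B (x , y) all4 u v = map₂ swap (all4 v u)

AllFour-edgeOf : (B : Matrix m n) (a : Bool) (j k : Fin m) →
                 AllFour B (j , k) → AllFour B (edgeOf a j k)
AllFour-edgeOf B false j k = id
AllFour-edgeOf B true  j k = AllFour-swap B (j , k)

AllFour-SamePair : (B : Matrix m n) → SamePair e f → AllFour B e → AllFour B f
AllFour-SamePair {e = _ , _} {f = _ , _} B (inj₁ (refl , refl)) = id
AllFour-SamePair {e = x , y} {f = _ , _} B (inj₂ (refl , refl)) = AllFour-swap B (x , y)

AllFour⇒¬Lacks01 : (B : Matrix m n) (e : Edge m) → AllFour B e → ¬ Lacks01 B e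
AllFour⇒¬Lacks01 B (x , y) all4 lacks =
  let β , βx≡0 , βy≡1 = all4 false true in lacks β βx≡0 βy≡1

Lacks01-deleteCol : (B : Matrix m (suc n)) (e : Edge m) (α : Fin (suc n)) →
                    Lacks01 B e → Lacks01 (deleteCol B α) e
Lacks01-deleteCol B (x , y) α lacks β = lacks (punchIn α β)

deleteCol-unique⇒Lacks01 : (A : Matrix m (suc n)) (a : Bool) (j k : Fin m)
                           (α : Fin (suc n)) →
  (∀ (β : Fin (suc n)) → A β j ≡ a → A β k ≡ not a → β ≡ α) →
  Lacks01 (deleteCol A α) (edgeOf a j k)
deleteCol-unique⇒Lacks01 A false j k α unique β βj≡0 βk≡1 =
  punchInᵢ≢i α β (unique (punchIn α β) βj≡0 βk≡1)
deleteCol-unique⇒Lacks01 A true  j k α unique β βk≡0 βj≡1 =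
  punchInᵢ≢i α β (unique (punchIn α β) βj≡1 βk≡0)

UndirectedSimple-∷ : All (λ f → ¬ SamePair f e) E → UndirectedSimple E →
                     UndirectedSimple (e ∷ E)
UndirectedSimple-∷ fresh simple zero    zero    p≢q = ⊥-elim (p≢q refl)
UndirectedSimple-∷ fresh simple zero    (suc q) _   = All.lookup fresh (∈-lookup q) ∘ SamePair-sym
UndirectedSimple-∷ fresh simple (suc p) zero    _   = All.lookup fresh (∈-lookup p)
UndirectedSimple-∷ fresh simple (suc p) (suc q) p≢q = simple p q (p≢q ∘ cong suc)

Lacks01⇒never-joined : {B : Matrix m n} (e : Edge m) → Lacks01 B e → ProcRun B E →
                       All (λ f → ¬ SamePair f e) E
Lacks01⇒never-joined e lacks (stop _) = []
Lacks01⇒never-joined {B = B} e lacks (step j k a α _ _ all4 _ _ _ run) =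
  (λ same → AllFour⇒¬Lacks01 B e (AllFour-SamePair B same (AllFour-edgeOf B a j k all4)) lacks)
  ∷ Lacks01⇒never-joined e (Lacks01-deleteCol B e α lacks) run

ProcRun-undirectedSimple : {A : Matrix m n} → ProcRun A E → UndirectedSimple E
ProcRun-undirectedSimple (stop _) ()
ProcRun-undirectedSimple {A = A} (step j k a α _ _ _ _ _ unique run) =
  UndirectedSimple-∷
    (Lacks01⇒never-joined (edgeOf a j k) (deleteCol-unique⇒Lacks01 A a j k α unique) run)
    (ProcRun-undirectedSimple run)

-- Avoidance and the column count are unused: they only ensure that a step
-- exists, whereas ProcRun already carries each step's hypotheses.
mainTheorem9 : ∀ (m n : ℕ) (A : Matrix m n) → InAvoid A → suc m < n →
    ∀ (E : List (Edge m)) → ProcRun A E → UndirectedSimple E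
mainTheorem9 m n A _ _ E = ProcRun-undirectedSimple
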